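{- Let $n\ge2$, let $\mathcal L$ be a finite set of pairwise distinct lines on the path with stations $1,\dots,n$, and let $l=[i,j]$, $l'=[i',j']$ be two lines of $\mathcal L$ with either $j<j'$, or $j=j'$ and $i>i'$. Write $a_l=(x,y)$ for the assignment of $l$ (left end $x$, right end $y$) and similarly $a_{l'}$, with $*$ meaning either value. Then in every admissible layout of $\mathcal L$ satisfying the periphery condition and realizing these assignments, $l$ and $l'$ cross, in each of the following cases: Type A ($i<i'<j<j'$): (1) $a_l=(\uparrow,\uparrow)$ and $a_{l'}=(\uparrow,*)$; (2) $a_l=(\uparrow,\downarrow)$ and $a_{l'}=(\downarrow,*)$; (3) $a_l=(\downarrow,\uparrow)$ and $a_{l'}=(\uparrow,*)$; (4) $a_l=(\downarrow,\downarrow)$ and $a_{l'}=(\downarrow,*)$. Type $\mathrm{C_l}$ ($i=i'$): (1) $a_l=(\uparrow,\downarrow)$ and $a_{l'}=(\downarrow,*)$; (2) $a_l=(\downarrow,\uparrow)$ and $a_{l'}=(\uparrow,*)$. Type $\mathrm{C_r}$ ($j=j'$): (1) $a_l=(\uparrow,\downarrow)$ and $a_{l'}=(*,\uparrow)$; (2) $a_l=(\downarrow,\uparrow)$ and $a_{l'}=(*,\downarrow)$. Type I ($i'<i<j<j'$): (1) $a_l=(\uparrow,\downarrow)$; (2) $a_l=(\downarrow,\uparrow)$.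
   Context: Stations $1,\dots,n$ lie in this order on a horizontal line, joined by edges $(i,i+1)$. A line is a pair $[i,j]$, $1\le i<j\le n$ (left end $i$, right end $j$), travelling along edges $(i,i+1),\dots,(j-1,j)$; $\mathcal L_{i,i+1}$ is the set of lines traversing edge $(i,i+1)$; $[a,b]$ passes through station $i$ if $a<i<b$. A layout specifies, for every edge $(i,i+1)$, a top-to-bottom order of $\mathcal L_{i,i+1}$ at its station-$i$ end and one at its station-$(i+1)$ end. Two lines cross on an edge if their relative order differs at the two ends. Admissible: any two lines passing through station $i$ have the same relative order at the station-$i$ ends of edges $(i-1,i)$ and $(i,i+1)$. Periphery condition: every line $[a,b]$ is, at the station-$a$ end of edge $(a,a+1)$, above all or below all lines of $\mathcal L_{a,a+1}$ passing through $a$, and at the station-$b$ end of edge $(b-1,b)$, above all or below all lines of $\mathcal L_{b-1,b}$ passing through $b$. The assignment of an end is $\uparrow$ (top) if the line lies above those passing lines there and $\downarrow$ (bottom) if below. -}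

module Defs where

open import Data.Nat using (ℕ; suc; _≤_; _<_; _∸_)
open import Data.Product using (_×_; _,_; proj₁; proj₂; ∃)
open import Data.Sum using (_⊎_)
open import Data.List using (List)
open import Data.List.Membership.Propositional using (_∈_)
open import Data.List.Relation.Unary.All using (All)
open import Data.List.Relation.Unary.Unique.Propositional using (Unique)
open import Relation.Binary.PropositionalEquality using (_≡_)
open import Function.Bundles using (_⇔_)

Line : Set
Line = ℕ × ℕ

WellFormedLine : ℕ → Line → Set
WellFormedLine n (i , j) = 1 ≤ i × i < j × j ≤ n

LineSet : ℕ → List Line → Set
LineSet n L = Unique L × All (WellFormedLine n) L

-- Edge k is the edge (k , k+1).  Line [a , b] traverses it iff a ≤ k and k+1 ≤ b.
Traverses : ℕ → Line → Set
Traverses k (a , b) = a ≤ k × k < b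

Passes : ℕ → Line → Set
Passes k (a , b) = a < k × k < b

-- A layout: for every edge (k , k+1) a top-to-bottom order of its lines at the
-- station-k end (lpos k) and at the station-(k+1) end (rpos k), given as ranks:
-- smaller rank = higher position.
record Layout : Set where
  field
    lpos : ℕ → Line → ℕ
    rpos : ℕ → Line → ℕ
open Layout public

IsLayout : List Line → Layout → Set
IsLayout L Λ = ∀ k l l' → l ∈ L → l' ∈ L → Traverses k l → Traverses k l' →
  (lpos Λ k l ≡ lpos Λ k l' → l ≡ l') × (rpos Λ k l ≡ rpos Λ k l' → l ≡ l')

CrossOn : Layout → ℕ → Line → Line → Set
CrossOn Λ k l l' = Traverses k l × Traverses k l' ×
  ((lpos Λ k l < lpos Λ k l' × rpos Λ k l' < rpos Λ k l)
   ⊎ (lpos Λ k l' < lpos Λ k l × rpos Λ k l < rpos Λ k l'))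

Cross : Layout → Line → Line → Set
Cross Λ l l' = ∃ λ k → CrossOn Λ k l l'

-- Admissible: lines passing through station m+1 keep their relative order
-- between the station-(m+1) ends of edges (m , m+1) and (m+1 , m+2).
Admissible : List Line → Layout → Set
Admissible L Λ = ∀ m l l' → l ∈ L → l' ∈ L → Passes (suc m) l → Passes (suc m) l' →
  (rpos Λ m l < rpos Λ m l' ⇔ lpos Λ (suc m) l < lpos Λ (suc m) l')

Periphery : List Line → Layout → Set
Periphery L Λ = ∀ a b → (a , b) ∈ L →
  ((∀ l' → l' ∈ L → Passes a l' → lpos Λ a (a , b) < lpos Λ a l')
   ⊎ (∀ l' → l' ∈ L → Passes a l' → lpos Λ a l' < lpos Λ a (a , b)))
  × ((∀ l' → l' ∈ L → Passes b l' → rpos Λ (b ∸ 1) (a , b) < rpos Λ (b ∸ 1) l')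
   ⊎ (∀ l' → l' ∈ L → Passes b l' → rpos Λ (b ∸ 1) l' < rpos Λ (b ∸ 1) (a , b)))

-- Assignment values: ↑ (top) and ↓ (bottom).
data Dir : Set where
  ↑ ↓ : Dir

flipDir : Dir → Dir
flipDir ↑ = ↓
flipDir ↓ = ↑

Assignment : Set
Assignment = Line → Dir × Dir

-- "x is above y" (d = ↑) or "x is below y" (d = ↓) in rank terms.
Side : Dir → ℕ → ℕ → Set
Side ↑ x y = x < y
Side ↓ x y = y < x

-- The layout realizes the assignment: every line [a , b] of L is, at the
-- station-a end of edge (a , a+1), on side (left value) of all lines passing
-- through a, and of all lines of L starting at a whose left value is the
-- opposite one (top terminals above bottom terminals); symmetrically at the
-- station-b end of edge (b-1 , b).
Realizes : List Line → Layout → Assignment → Set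
Realizes L Λ asg = ∀ a b → (a , b) ∈ L →
  (∀ l' → l' ∈ L →
     (Passes a l' ⊎ (proj₁ l' ≡ a × proj₁ (asg l') ≡ flipDir (proj₁ (asg (a , b))))) →
     Side (proj₁ (asg (a , b))) (lpos Λ a (a , b)) (lpos Λ a l'))
  × (∀ l' → l' ∈ L →
     (Passes b l' ⊎ (proj₂ l' ≡ b × proj₂ (asg l') ≡ flipDir (proj₂ (asg (a , b))))) →
     Side (proj₂ (asg (a , b))) (rpos Λ (b ∸ 1) (a , b)) (rpos Λ (b ∸ 1) l'))

data ForcedCase (i j i' j' : ℕ) (x y x' y' : Dir) : Set where
  A1  : i < i' → i' < j → j < j' → x ≡ ↑ → y ≡ ↑ → x' ≡ ↑ → ForcedCase i j i' j' x y x' y'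
  A2  : i < i' → i' < j → j < j' → x ≡ ↑ → y ≡ ↓ → x' ≡ ↓ → ForcedCase i j i' j' x y x' y'
  A3  : i < i' → i' < j → j < j' → x ≡ ↓ → y ≡ ↑ → x' ≡ ↑ → ForcedCase i j i' j' x y x' y'
  A4  : i < i' → i' < j → j < j' → x ≡ ↓ → y ≡ ↓ → x' ≡ ↓ → ForcedCase i j i' j' x y x' y'
  Cl1 : i ≡ i' → x ≡ ↑ → y ≡ ↓ → x' ≡ ↓ → ForcedCase i j i' j' x y x' y'
  Cl2 : i ≡ i' → x ≡ ↓ → y ≡ ↑ → x' ≡ ↑ → ForcedCase i j i' j' x y x' y'
  Cr1 : j ≡ j' → x ≡ ↑ → y ≡ ↓ → y' ≡ ↑ → ForcedCase i j i' j' x y x' y'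
  Cr2 : j ≡ j' → x ≡ ↓ → y ≡ ↑ → y' ≡ ↓ → ForcedCase i j i' j' x y x' y'
  I1  : i' < i → i < j → j < j' → x ≡ ↑ → y ≡ ↓ → ForcedCase i j i' j' x y x' y'
  I2  : i' < i → i < j → j < j' → x ≡ ↓ → y ≡ ↑ → ForcedCase i j i' j' x y x' y'

module Submission where

-- Two distinct lines p and q that both run from station s to
-- station t (s < t) and whose relative order at station s is the reverse of
-- their relative order at station t must cross on some edge between s and t:
-- walking edge by edge, admissibility carries the order unchanged across
-- every intermediate station, so only a crossing on an edge can reverse it.
--
-- The theorem then only has to exhibit such a reversal.  The realization of
-- the assignment pins down, at each end of l (or of l'), on which side the
-- other line lies.  In type A the order of l, l' at station i' is fixed by
-- the left value of l' and at station j by the right value of l; these are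
-- equal, which reverses the order.  In types C_l, C_r and I both orders are
-- fixed by l itself, whose two values are opposite.  The hypothesis on the
-- order of l, l' (j < j', or j = j' and i' < i) makes the lines distinct.

open import Defs
open import Data.Nat using (ℕ; suc; _∸_; _≤_; _<_; _≤‴_; ≤‴-refl; ≤‴-step; s≤s)
open import Data.Nat.Properties
  using (<-cmp; <-asym; <-irrefl; <-trans; <⇒≤; ≤-refl; ≤-reflexive; ≤-trans; <-≤-trans; ≤-<-trans;
         m≤n⇒m≤1+n; <⇒≤pred; ≤⇒≤‴; ≤‴⇒≤)
open import Data.Product using (_×_; _,_; proj₁; proj₂)
open import Data.Sum using (_⊎_; inj₁; inj₂)
open import Data.List using (List)
open import Data.List.Membership.Propositional using (_∈_)
open import Data.List.Relation.Unary.All using (lookup)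
open import Data.Empty using (⊥-elim)
open import Relation.Binary.PropositionalEquality using (_≡_; _≢_; refl; sym; trans; cong; subst)
open import Relation.Binary.Definitions using (tri<; tri≈; tri>)
open import Function.Bundles using (Equivalence)

Opposed : ℕ → ℕ → ℕ → ℕ → Set
Opposed u v u' v' = (u < v × v' < u') ⊎ (v < u × u' < v')

Opposed-sym : ∀ {u v u' v'} → Opposed u v u' v' → Opposed v u v' u'
Opposed-sym (inj₁ (u<v , v'<u')) = inj₂ (u<v , v'<u')
Opposed-sym (inj₂ (v<u , u'<v')) = inj₁ (v<u , u'<v')

Cross-sym : ∀ {Λ p q} → Cross Λ p q → Cross Λ q p
Cross-sym (k , tp , tq , opp) = k , tq , tp , Opposed-sym opp

Side-flip : ∀ d {u v} → Side d u v → Side (flipDir d) v u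
Side-flip ↑ u<v = u<v
Side-flip ↓ v<u = v<u

same-side-opposed : ∀ d {u v u' v'} → Side d v u → Side d u' v' → Opposed u v u' v'
same-side-opposed ↑ v<u u'<v' = inj₂ (v<u , u'<v')
same-side-opposed ↓ u<v v'<u' = inj₁ (u<v , v'<u')

flipped-side-opposed : ∀ d {u v u' v'} → Side d u v → Side (flipDir d) u' v' → Opposed u v u' v'
flipped-side-opposed d u-v u'-v' = same-side-opposed (flipDir d) (Side-flip d u-v) u'-v'

traverses-next : ∀ {s e} (p : Line) → Traverses s p → Traverses e p → suc s ≤ e →
  Traverses (suc s) p
traverses-next p (a≤s , _) (_ , e<b) s<e = m≤n⇒m≤1+n a≤s , ≤-<-trans s<e e<b

passes-next : ∀ {s e} (p : Line) → Traverses s p → Traverses e p → suc s ≤ e →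
  Passes (suc s) p
passes-next p (a≤s , _) (_ , e<b) s<e = s≤s a≤s , ≤-<-trans s<e e<b

module EdgeWalk {L : List Line} {Λ : Layout} (isL : IsLayout L Λ) (adm : Admissible L Λ)
  {p q : Line} (p∈L : p ∈ L) (q∈L : q ∈ L) (p≢q : p ≢ q) where

  -- Either they cross on edge s, or p is still above q at its right end, and
  -- admissibility hands this order to the left end of edge s+1.
  descent-crosses : ∀ {s e} → s ≤‴ e →
    Traverses s p → Traverses s q → Traverses e p → Traverses e q →
    lpos Λ s p < lpos Λ s q → rpos Λ e q < rpos Λ e p → Cross Λ p q
  descent-crosses {s} s≤e tsp tsq tep teq left right
    with <-cmp (rpos Λ s p) (rpos Λ s q)
  ... | tri> _ _ q<p = s , tsp , tsq , inj₁ (left , q<p)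
  ... | tri≈ _ same _ = ⊥-elim (p≢q (proj₂ (isL s p q p∈L q∈L tsp tsq) same))
  ... | tri< p<q _ _ with s≤e
  ...   | ≤‴-refl = ⊥-elim (<-asym p<q right)
  ...   | ≤‴-step s<e =
    descent-crosses s<e (traverses-next p tsp tep s<e′) (traverses-next q tsq teq s<e′) tep teq
      (Equivalence.to (adm s p q p∈L q∈L (passes-next p tsp tep s<e′) (passes-next q tsq teq s<e′)) p<q)
      right
    where
    s<e′ : suc s ≤ _
    s<e′ = ≤‴⇒≤ s<e

traverses-first : ∀ {a b s t} → a ≤ s → s < t → t ≤ b → Traverses s (a , b)
traverses-first a≤s s<t t≤b = a≤s , <-≤-trans s<t t≤b

traverses-last : ∀ {a b s t} → a ≤ s → s < t → t ≤ b → Traverses (t ∸ 1) (a , b)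
traverses-last a≤s (s≤s s≤t₀) t≤b = ≤-trans a≤s s≤t₀ , t≤b

reversal-crosses : ∀ {L Λ} → IsLayout L Λ → Admissible L Λ →
  ∀ {a b a' b' s t} → (a , b) ∈ L → (a' , b') ∈ L → (a , b) ≢ (a' , b') →
  a ≤ s → a' ≤ s → s < t → t ≤ b → t ≤ b' →
  Opposed (lpos Λ s (a , b)) (lpos Λ s (a' , b')) (rpos Λ (t ∸ 1) (a , b)) (rpos Λ (t ∸ 1) (a' , b')) →
  Cross Λ (a , b) (a' , b')
reversal-crosses isL adm p∈L q∈L p≢q a≤s a'≤s s<t t≤b t≤b' (inj₁ (left , right)) =
  EdgeWalk.descent-crosses isL adm p∈L q∈L p≢q (≤⇒≤‴ (<⇒≤pred s<t))
    (traverses-first a≤s s<t t≤b) (traverses-first a'≤s s<t t≤b')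
    (traverses-last a≤s s<t t≤b) (traverses-last a'≤s s<t t≤b') left right
reversal-crosses isL adm p∈L q∈L p≢q a≤s a'≤s s<t t≤b t≤b' (inj₂ (left , right)) =
  Cross-sym (EdgeWalk.descent-crosses isL adm q∈L p∈L (λ eq → p≢q (sym eq)) (≤⇒≤‴ (<⇒≤pred s<t))
    (traverses-first a'≤s s<t t≤b') (traverses-first a≤s s<t t≤b)
    (traverses-last a'≤s s<t t≤b') (traverses-last a≤s s<t t≤b) left right)

flank-left : ∀ {a} {P : Set} (l' : Line) → Passes a l' ⊎ (proj₁ l' ≡ a × P) → proj₁ l' ≤ a
flank-left l' (inj₁ (a'<a , _)) = <⇒≤ a'<a
flank-left l' (inj₂ (a'≡a , _)) = ≤-reflexive a'≡a

flank-right : ∀ {b} {P : Set} (l' : Line) → Passes b l' ⊎ (proj₂ l' ≡ b × P) → b ≤ proj₂ l'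
flank-right l' (inj₁ (_ , b<b')) = <⇒≤ b<b'
flank-right l' (inj₂ (b'≡b , _)) = ≤-reflexive (sym b'≡b)

OrderedPair : ℕ → ℕ → ℕ → ℕ → Set
OrderedPair i j i' j' = j < j' ⊎ (j ≡ j' × i' < i)

ordered-distinct : ∀ {i j i' j'} → OrderedPair i j i' j' → (i , j) ≢ (i' , j')
ordered-distinct (inj₁ j<j') eq = <-irrefl (cong proj₂ eq) j<j'
ordered-distinct (inj₂ (_ , i'<i)) eq = <-irrefl (sym (cong proj₁ eq)) i'<i

ordered-same-left : ∀ {i j i' j'} → i ≡ i' → OrderedPair i j i' j' → j < j'
ordered-same-left _ (inj₁ j<j') = j<j'
ordered-same-left i≡i' (inj₂ (_ , i'<i)) = ⊥-elim (<-irrefl (sym i≡i') i'<i)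

ordered-same-right : ∀ {i j i' j'} → j ≡ j' → OrderedPair i j i' j' → i' < i
ordered-same-right j≡j' (inj₁ j<j') = ⊥-elim (<-irrefl j≡j' j<j')
ordered-same-right _ (inj₂ (_ , i'<i)) = i'<i

opposite-values : ∀ {x y c} → x ≡ c → y ≡ flipDir c → y ≡ flipDir x
opposite-values x≡c y≡c̄ = trans y≡c̄ (cong flipDir (sym x≡c))

module Realized {L : List Line} {Λ : Layout} (isL : IsLayout L Λ) (adm : Admissible L Λ)
  {asg : Assignment} (R : Realizes L Λ asg)
  {i j i' j' : ℕ} (l∈L : (i , j) ∈ L) (l'∈L : (i' , j') ∈ L) where

  -- Type A: l' starts inside l and l ends inside l'.  At station i' line l
  -- lies on side x' of l', and at station j line l' lies on side y of l;
  -- when x' = y the two orders are reversed.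
  staggered : i < i' → i' < j → j < j' → proj₂ (asg (i , j)) ≡ proj₁ (asg (i' , j')) →
    Cross Λ (i , j) (i' , j')
  staggered i<i' i'<j j<j' y≡x' =
    reversal-crosses isL adm l∈L l'∈L (λ eq → <-irrefl (cong proj₁ eq) i<i')
      (<⇒≤ i<i') ≤-refl i'<j ≤-refl (<⇒≤ j<j')
      (same-side-opposed (proj₁ (asg (i' , j'))) l'-over-l (subst (λ d → Side d _ _) y≡x' l-over-l'))
    where
    l'-over-l : Side (proj₁ (asg (i' , j'))) (lpos Λ i' (i' , j')) (lpos Λ i' (i , j))
    l'-over-l = proj₁ (R i' j' l'∈L) (i , j) l∈L (inj₁ (i<i' , i'<j))
    l-over-l' : Side (proj₂ (asg (i , j))) (rpos Λ (j ∸ 1) (i , j)) (rpos Λ (j ∸ 1) (i' , j'))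
    l-over-l' = proj₂ (R i j l∈L) (i' , j') l'∈L (inj₁ (i'<j , j<j'))

  -- Types C and I: l' flanks both ends of l.  There l lies on side x resp. y
  -- of l'; when y = flip x the two orders are reversed.
  nested : (i , j) ≢ (i' , j') → i < j →
    Passes i (i' , j') ⊎ (i' ≡ i × proj₁ (asg (i' , j')) ≡ flipDir (proj₁ (asg (i , j)))) →
    Passes j (i' , j') ⊎ (j' ≡ j × proj₂ (asg (i' , j')) ≡ flipDir (proj₂ (asg (i , j)))) →
    proj₂ (asg (i , j)) ≡ flipDir (proj₁ (asg (i , j))) →
    Cross Λ (i , j) (i' , j')
  nested l≢l' i<j left right y≡x̄ =
    reversal-crosses isL adm l∈L l'∈L l≢l' ≤-refl (flank-left (i' , j') left) i<j ≤-refl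
      (flank-right (i' , j') right)
      (flipped-side-opposed (proj₁ (asg (i , j))) (proj₁ (R i j l∈L) (i' , j') l'∈L left)
        (subst (λ d → Side d _ _) y≡x̄ (proj₂ (R i j l∈L) (i' , j') l'∈L right)))

fact1 : (n : ℕ) → 2 ≤ n → (L : List Line) → LineSet n L →
    (i j i' j' : ℕ) → (i , j) ∈ L → (i' , j') ∈ L →
    (j < j' ⊎ (j ≡ j' × i' < i)) →
    (Λ : Layout) → IsLayout L Λ → Admissible L Λ → Periphery L Λ →
    (asg : Assignment) → Realizes L Λ asg →
    ForcedCase i j i' j' (proj₁ (asg (i , j))) (proj₂ (asg (i , j))) (proj₁ (asg (i' , j'))) (proj₂ (asg (i' , j'))) →
    Cross Λ (i , j) (i' , j')
fact1 _ _ L (_ , wellFormed) i j i' j' l∈L l'∈L order Λ isL adm _ asg R = forced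
  where
  open Realized isL adm R l∈L l'∈L

  i<j : i < j
  i<j = proj₁ (proj₂ (lookup wellFormed l∈L))

  distinct : (i , j) ≢ (i' , j')
  distinct = ordered-distinct order

  same-left : i ≡ i' → Passes j (i' , j')
  same-left i≡i' = subst (_< j) i≡i' i<j , ordered-same-left i≡i' order

  same-right : j ≡ j' → Passes i (i' , j')
  same-right j≡j' = ordered-same-right j≡j' order , subst (i <_) j≡j' i<j

  forced : ForcedCase i j i' j' (proj₁ (asg (i , j))) (proj₂ (asg (i , j)))
             (proj₁ (asg (i' , j'))) (proj₂ (asg (i' , j'))) → Cross Λ (i , j) (i' , j')
  forced (A1 i<i' i'<j j<j' _ y↑ x'↑) = staggered i<i' i'<j j<j' (trans y↑ (sym x'↑))
  forced (A2 i<i' i'<j j<j' _ y↓ x'↓) = staggered i<i' i'<j j<j' (trans y↓ (sym x'↓))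
  forced (A3 i<i' i'<j j<j' _ y↑ x'↑) = staggered i<i' i'<j j<j' (trans y↑ (sym x'↑))
  forced (A4 i<i' i'<j j<j' _ y↓ x'↓) = staggered i<i' i'<j j<j' (trans y↓ (sym x'↓))
  forced (Cl1 i≡i' x↑ y↓ x'↓) = nested distinct i<j (inj₂ (sym i≡i' , opposite-values x↑ x'↓))
    (inj₁ (same-left i≡i')) (opposite-values x↑ y↓)
  forced (Cl2 i≡i' x↓ y↑ x'↑) = nested distinct i<j (inj₂ (sym i≡i' , opposite-values x↓ x'↑))
    (inj₁ (same-left i≡i')) (opposite-values x↓ y↑)
  forced (Cr1 j≡j' x↑ y↓ y'↑) = nested distinct i<j (inj₁ (same-right j≡j'))
    (inj₂ (sym j≡j' , opposite-values y↓ y'↑)) (opposite-values x↑ y↓)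
  forced (Cr2 j≡j' x↓ y↑ y'↓) = nested distinct i<j (inj₁ (same-right j≡j'))
    (inj₂ (sym j≡j' , opposite-values y↑ y'↓)) (opposite-values x↓ y↑)
  forced (I1 i'<i _ j<j' x↑ y↓) = nested distinct i<j (inj₁ (i'<i , <-trans i<j j<j'))
    (inj₁ (<-trans i'<i i<j , j<j')) (opposite-values x↑ y↓)
  forced (I2 i'<i _ j<j' x↓ y↑) = nested distinct i<j (inj₁ (i'<i , <-trans i<j j<j'))
    (inj₁ (<-trans i'<i i<j , j<j')) (opposite-values x↓ y↑)
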